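{- Let $p\ge 5$ be a prime with $\chi_3(p)=1$. Then for all integers $m,r\ge 1$, \[ c_{mp^r}^{\mathrm{mix}}\equiv c_{mp^{r-1}}^{\mathrm{mix}}\pmod{p^{4r}}. \]
   Context: $\chi_3$ is the nontrivial Dirichlet character modulo $3$. For $n\ge1$, $s(n):=\sum_{d\mid n}\chi_3(d)d^4$, $\beta(n):=\sum_{d\mid n}\chi_3(n/d)d^4$, and $c_n^{\mathrm{mix}}:=3s(n)-27\beta(n)$. -}

module Defs where

open import Data.Nat as ℕ using (ℕ; zero; suc; _%_; _/_)
open import Data.Nat.Divisibility using (_∣?_)
open import Data.Integer as ℤ using (ℤ; +_; -_)
open import Data.List using (List; []; _∷_; filter; map; foldr; upTo)
open import Data.Integer.Divisibility using (_∣_)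

χ₃ : ℕ → ℤ
χ₃ n with n % 3
... | 0 = + 0
... | 1 = + 1
... | _ = - (+ 1)

sumℤ : List ℤ → ℤ
sumℤ = foldr ℤ._+_ (+ 0)

-- the positive divisors d of n, written d = suc k, i.e. k ranges over 0..n-1 with suc k ∣ n
divisorsPred : ℕ → List ℕ
divisorsPred n = filter (λ k → suc k ∣? n) (upTo n)

s : ℕ → ℤ
s n = sumℤ (map (λ k → χ₃ (suc k) ℤ.* (+ (suc k ℕ.^ 4))) (divisorsPred n))

β : ℕ → ℤ
β n = sumℤ (map (λ k → χ₃ (n / suc k) ℤ.* (+ (suc k ℕ.^ 4))) (divisorsPred n))

cmix : ℕ → ℤ
cmix n = (+ 3) ℤ.* s n ℤ.- (+ 27) ℤ.* β n

{-# OPTIONS --safe #-}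
-- Put M = m p^(r-1), so that m p^r = p M. A divisor d of pM that does not divide M has a
-- cofactor pM/d prime to p, hence p^r ∣ d and its term d⁴ vanishes modulo p^(4r). The other
-- divisors of pM are exactly those of M: for them the terms of s agree verbatim, and those of β
-- agree because χ₃(pM/d) = χ₃(p) χ₃(M/d) = χ₃(M/d).
module Submission where

open import Defs
open import Data.Nat using (ℕ; suc; _*_; _^_; _≤_; _∸_)
open import Data.Nat.Primality using (Prime)
open import Data.Integer using (+_; _-_)
open import Data.Integer.Divisibility using (_∣_)
open import Relation.Binary.PropositionalEquality using (_≡_)

open import Data.Nat.Base as ℕ using (zero; _%_; _/_; NonZero)
open import Data.Nat.Properties as ℕ using (m≤n⇒m<n∨m≡n)
open import Data.Nat.DivMod using (%-distribˡ-*; m%n%n≡m%n; *-/-assoc)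
open import Data.Nat.Divisibility as ℕ
  using (_∤_; divides; ∣-refl; ∣-trans; *-pres-∣; *-monoʳ-∣; *-cancelˡ-∣; m∣m*n; 1∣_; ∣⇒≤; >⇒∤; _∣?_)
open import Data.Nat.Primality using (euclidsLemma; prime⇒nonZero)
open import Algebra.Properties.CommutativeSemigroup ℕ.*-commutativeSemigroup
  using (x∙yz≈y∙xz; x∙yz≈z∙xy; xy∙z≈y∙xz)
open import Data.Integer.Base as ℤ using (ℤ)
open import Data.Integer.Divisibility.Signed as ℤ
  using (∣⇒∣ᵤ; ∣ᵤ⇒∣; ∣m∣n⇒∣m+n; ∣m∣n⇒∣m-n; ∣n⇒∣m*n)
open import Data.Integer.Tactic.RingSolver as ℤ-Solver using ()
open import Data.List using ([]; _∷_; filter; map; upTo; _++_)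
open import Data.List.Properties using (upTo-∷ʳ; filter-++; filter-reject; ++-identityʳ)
open import Data.Sum using (inj₁; inj₂)
open import Function using (_∘_)
open import Level using (0ℓ)
open import Relation.Nullary using (¬_; yes; no; contradiction)
open import Relation.Unary using (Pred; Decidable)
open import Relation.Binary.PropositionalEquality using (refl; sym; trans; cong; subst; subst₂; module ≡-Reasoning)

χ₃-cong-% : ∀ m n → m % 3 ≡ n % 3 → χ₃ m ≡ χ₃ n
χ₃-cong-% m n eq with m % 3 | n % 3 | eq
... | _ | _ | refl = refl

χ₃≡1⇒%3≡1 : ∀ n → χ₃ n ≡ + 1 → n % 3 ≡ 1
χ₃≡1⇒%3≡1 n eq with n % 3 | eq
... | 1 | _ = refl

%3≡1⇒χ₃[p*n]≡χ₃[n] : ∀ p n → p % 3 ≡ 1 → χ₃ (p * n) ≡ χ₃ n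
%3≡1⇒χ₃[p*n]≡χ₃[n] p n p%3≡1 = χ₃-cong-% (p * n) n (begin
  (p * n) % 3                  ≡⟨ %-distribˡ-* p n 3 ⟩
  ((p % 3) * (n % 3)) % 3      ≡⟨ cong (λ t → (t * (n % 3)) % 3) p%3≡1 ⟩
  (1 * (n % 3)) % 3            ≡⟨ cong (_% 3) (ℕ.*-identityˡ (n % 3)) ⟩
  (n % 3) % 3                  ≡⟨ m%n%n≡m%n n 3 ⟩
  n % 3                        ∎)
  where open ≡-Reasoning

^-monoˡ-∣ : ∀ {m n} k → m ℕ.∣ n → m ^ k ℕ.∣ n ^ k
^-monoˡ-∣ zero    _   = ∣-refl
^-monoˡ-∣ (suc k) m∣n = *-pres-∣ m∣n (^-monoˡ-∣ k m∣n)

prime^∣*⇒∣ : ∀ {p e d} → Prime p → p ∤ e → ∀ r → p ^ r ℕ.∣ e * d → p ^ r ℕ.∣ d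
prime^∣*⇒∣ _ _ zero _ = 1∣ _
prime^∣*⇒∣ {p} {e} pr p∤e (suc r) p^[1+r]∣e*d
  with euclidsLemma e _ pr (∣-trans (m∣m*n (p ^ r)) p^[1+r]∣e*d)
... | inj₁ p∣e = contradiction p∣e p∤e
... | inj₂ (divides q refl) =
  subst (p ^ suc r ℕ.∣_) (ℕ.*-comm p q) (*-monoʳ-∣ p p^r∣q)
  where
  p^r∣q : p ^ r ℕ.∣ q
  p^r∣q = prime^∣*⇒∣ pr p∤e r (*-cancelˡ-∣ p {{prime⇒nonZero pr}}
    (subst (p * p ^ r ℕ.∣_) (x∙yz≈z∙xy e q p) p^[1+r]∣e*d))

prime^∣⇒∣-divisor-∤ : ∀ {p M d} → Prime p → d ℕ.∣ p * M → d ∤ M →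
                      ∀ r → p ^ r ℕ.∣ p * M → p ^ r ℕ.∣ d
prime^∣⇒∣-divisor-∤ {p} {M} {d} pr (divides e p*M≡e*d) d∤M r p^r∣p*M =
  prime^∣*⇒∣ pr p∤e r (subst (p ^ r ℕ.∣_) p*M≡e*d p^r∣p*M)
  where
  p∤e : p ∤ e
  p∤e (divides q refl) = d∤M (divides q
    (ℕ.*-cancelˡ-≡ M (q * d) p {{prime⇒nonZero pr}} (trans p*M≡e*d (xy∙z≈y∙xz q p d))))

∣-sum-filter-difference : ∀ {A : Set} {P Q : Pred A 0ℓ} (P? : Decidable P) (Q? : Decidable Q)
  {a : ℤ} (f g : A → ℤ) → (∀ {x} → Q x → P x) → (∀ {x} → Q x → f x ≡ g x) →
  (∀ {x} → P x → ¬ Q x → a ℤ.∣ f x) →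
  ∀ xs → a ℤ.∣ sumℤ (map f (filter P? xs)) - sumℤ (map g (filter Q? xs))
∣-sum-filter-difference P? Q? {a} f g Q⊆P f≡g a∣f = go
  where
  cancel : ∀ u x y → (u ℤ.+ x) - (u ℤ.+ y) ≡ x - y
  cancel = ℤ-Solver.solve-∀
  reassoc : ∀ u x y → (u ℤ.+ x) - y ≡ u ℤ.+ (x - y)
  reassoc = ℤ-Solver.solve-∀
  go : ∀ xs → a ℤ.∣ sumℤ (map f (filter P? xs)) - sumℤ (map g (filter Q? xs))
  go [] = ℤ.divides (+ 0) refl
  go (x ∷ xs) with P? x | Q? x
  ... | yes _  | yes qx rewrite f≡g qx = subst (a ℤ.∣_) (sym (cancel (g x) _ _)) (go xs)
  ... | yes px | no ¬qx = subst (a ℤ.∣_) (sym (reassoc (f x) _ _)) (∣m∣n⇒∣m+n (a∣f px ¬qx) (go xs))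
  ... | no ¬px | yes qx = contradiction (Q⊆P qx) ¬px
  ... | no _   | no _   = go xs

filter-∣-upTo : ∀ {M} .{{_ : NonZero M}} n → M ≤ n →
                filter (λ k → suc k ∣? M) (upTo n) ≡ divisorsPred M
filter-∣-upTo n M≤n with m≤n⇒m<n∨m≡n M≤n
filter-∣-upTo n _ | inj₂ refl = refl
filter-∣-upTo zero _ | inj₁ ()
filter-∣-upTo {M} (suc n) _ | inj₁ M<1+n = begin
  filter D? (upTo (suc n))                  ≡⟨ cong (filter D?) (upTo-∷ʳ n) ⟨
  filter D? (upTo n ++ n ∷ [])              ≡⟨ filter-++ D? (upTo n) _ ⟩
  filter D? (upTo n) ++ filter D? (n ∷ [])  ≡⟨ cong (filter D? (upTo n) ++_) (filter-reject D? (>⇒∤ M<1+n)) ⟩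
  filter D? (upTo n) ++ []                  ≡⟨ ++-identityʳ _ ⟩
  filter D? (upTo n)                        ≡⟨ filter-∣-upTo n (ℕ.≤-pred M<1+n) ⟩
  divisorsPred M                            ∎
  where
  open ≡-Reasoning
  D? : Decidable (λ k → suc k ℕ.∣ M)
  D? = λ k → suc k ∣? M

∣-divisorSum-difference : ∀ {a M N} .{{_ : NonZero M}} .{{_ : NonZero N}} → M ℕ.∣ N →
  (f g : ℕ → ℤ) → (∀ {k} → suc k ℕ.∣ M → f k ≡ g k) →
  (∀ {k} → suc k ℕ.∣ N → suc k ∤ M → a ℤ.∣ f k) →
  a ℤ.∣ sumℤ (map f (divisorsPred N)) - sumℤ (map g (divisorsPred M))
∣-divisorSum-difference {a} {M} {N} M∣N f g f≡g a∣f =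
  subst (λ ds → a ℤ.∣ sumℤ (map f (divisorsPred N)) - sumℤ (map g ds)) (filter-∣-upTo N (∣⇒≤ M∣N))
    (∣-sum-filter-difference (λ k → suc k ∣? N) (λ k → suc k ∣? M) f g
      (λ d∣M → ∣-trans d∣M M∣N) f≡g a∣f (upTo N))

divisorSum⁴-congruence : ∀ {p M} .{{_ : NonZero M}} → Prime p → ∀ r → p ^ r ℕ.∣ p * M →
  (a b : ℕ → ℤ) → (∀ {k} → suc k ℕ.∣ M → a k ≡ b k) →
  + ((p ^ r) ^ 4) ℤ.∣ sumℤ (map (λ k → a k ℤ.* + (suc k ^ 4)) (divisorsPred (p * M)))
                      - sumℤ (map (λ k → b k ℤ.* + (suc k ^ 4)) (divisorsPred M))
divisorSum⁴-congruence {p} {M} pr r p^r∣p*M a b a≡b =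
  ∣-divisorSum-difference (ℕ.n∣m*n p) _ _
    (λ {k} d∣M → cong (ℤ._* + (suc k ^ 4)) (a≡b d∣M))
    (λ d∣p*M d∤M → ∣n⇒∣m*n (a _) (∣ᵤ⇒∣ (^-monoˡ-∣ 4 (prime^∣⇒∣-divisor-∤ pr d∣p*M d∤M r p^r∣p*M))))
  where
  instance
    p*M≢0 : NonZero (p * M)
    p*M≢0 = ℕ.m*n≢0 p M {{prime⇒nonZero pr}}

s-congruence : ∀ {p M} .{{_ : NonZero M}} → Prime p → ∀ r → p ^ r ℕ.∣ p * M →
               + ((p ^ r) ^ 4) ℤ.∣ s (p * M) - s M
s-congruence pr r p^r∣p*M = divisorSum⁴-congruence pr r p^r∣p*M (χ₃ ∘ suc) (χ₃ ∘ suc) (λ _ → refl)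

β-congruence : ∀ {p M} .{{_ : NonZero M}} → Prime p → p % 3 ≡ 1 → ∀ r → p ^ r ℕ.∣ p * M →
               + ((p ^ r) ^ 4) ℤ.∣ β (p * M) - β M
β-congruence {p} {M} pr p%3≡1 r p^r∣p*M =
  divisorSum⁴-congruence pr r p^r∣p*M (λ k → χ₃ (p * M / suc k)) (λ k → χ₃ (M / suc k)) χ₃-cofactor
  where
  χ₃-cofactor : ∀ {k} → suc k ℕ.∣ M → χ₃ (p * M / suc k) ≡ χ₃ (M / suc k)
  χ₃-cofactor {k} d∣M = trans (cong χ₃ (*-/-assoc p d∣M)) (%3≡1⇒χ₃[p*n]≡χ₃[n] p (M / suc k) p%3≡1)

cmix-congruence : ∀ {p M} .{{_ : NonZero M}} → Prime p → p % 3 ≡ 1 → ∀ r → p ^ r ℕ.∣ p * M →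
                  + ((p ^ r) ^ 4) ℤ.∣ cmix (p * M) - cmix M
cmix-congruence {p} {M} pr p%3≡1 r p^r∣p*M =
  subst (_ ℤ.∣_) (sym (difference (+ 3) (+ 27) (s (p * M)) (s M) (β (p * M)) (β M)))
    (∣m∣n⇒∣m-n (∣n⇒∣m*n (+ 3) (s-congruence pr r p^r∣p*M))
               (∣n⇒∣m*n (+ 27) (β-congruence pr p%3≡1 r p^r∣p*M)))
  where
  difference : ∀ a b x x′ y y′ →
    (a ℤ.* x - b ℤ.* y) - (a ℤ.* x′ - b ℤ.* y′) ≡ a ℤ.* (x - x′) - b ℤ.* (y - y′)
  difference = ℤ-Solver.solve-∀

-- The hypothesis 5 ≤ p is redundant: χ₃ p ≡ + 1 already rules out p = 2, 3.
theorem5p1 : (p : ℕ) → Prime p → 5 ≤ p → χ₃ p ≡ + 1 →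
    (m r : ℕ) → 1 ≤ m → 1 ≤ r →
    (+ (p ^ (4 * r))) ∣ (cmix (m * p ^ r) - cmix (m * p ^ (r ∸ 1)))
theorem5p1 p pr _ χ₃p≡1 m (suc r) 1≤m _ =
  ∣⇒∣ᵤ (subst₂ (λ P N → + P ℤ.∣ cmix N - cmix M) exponent (sym m*p^[1+r]≡p*M)
    (cmix-congruence pr (χ₃≡1⇒%3≡1 p χ₃p≡1) (suc r) (divides m (sym m*p^[1+r]≡p*M))))
  where
  M : ℕ
  M = m * p ^ r
  instance
    M≢0 : NonZero M
    M≢0 = ℕ.m*n≢0 m (p ^ r) {{ℕ.>-nonZero 1≤m}} {{ℕ.m^n≢0 p r {{prime⇒nonZero pr}}}}
  m*p^[1+r]≡p*M : m * p ^ suc r ≡ p * M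
  m*p^[1+r]≡p*M = x∙yz≈y∙xz m p (p ^ r)
  exponent : (p ^ suc r) ^ 4 ≡ p ^ (4 * suc r)
  exponent = trans (ℕ.^-*-assoc p (suc r) 4) (cong (p ^_) (ℕ.*-comm (suc r) 4))
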